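{- Every Kripke-polynomial 2-functor $T:\mathcal V\text{ -cat}\to\mathcal V\text{ -cat}$, i.e. every $T$ generated by the grammar $T::=\mathrm{Id}\mid\mathrm{const}_{\mathcal X}\mid T+T\mid T\otimes T\mid T^\partial\mid\mathsf L T$, satisfies the Beck–Chevalley Condition.
   Context: $\mathcal V=(\mathcal V_o,\otimes,I,[-,-])$ is a commutative quantale: $\mathcal V_o$ a complete lattice (least element $\bot$), $\otimes$ commutative associative with unit $I$ preserving joins in each variable, $x\otimes y\le z$ iff $y\le[x,z]$. $\mathcal V$-categories have hom-values $\mathcal A(a,b)\in\mathcal V_o$ with $I\le\mathcal A(a,a)$, $\mathcal A(b,c)\otimes\mathcal A(a,b)\le\mathcal A(a,c)$; $\mathcal V$-functors satisfy $\mathcal A(a,a')\le\mathcal B(fa,fa')$; $f\le g$ iff $I\le\mathcal B(fa,ga)$ for all $a$; $\mathcal A^{op}(a,b)=\mathcal A(b,a)$. $\mathcal V\text{ -cat}$: 2-category of small $\mathcal V$-categories, $\mathcal V$-functors and $\le$. A lax square is $p_0:\mathcal P\to\mathcal A$, $p_1:\mathcal P\to\mathcal B$, $f:\mathcal A\to\mathcal C$, $g:\mathcal B\to\mathcal C$ with $fp_0\le gp_1$; it is exact if $\mathcal C(fa,gb)=\bigvee_w\mathcal A(a,p_0w)\otimes\mathcal B(p_1w,b)$ for all $a,b$; $T$ satisfies BCC if it sends exact lax squares to exact lax squares. The constructors: $\mathrm{Id}$ is the identity; $\mathrm{const}_{\mathcal X}$ sends every object to a fixed small $\mathcal X$ and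 every 1-cell to $1_{\mathcal X}$; $(T_1+T_2)\mathcal A=T_1\mathcal A+T_2\mathcal A$ (disjoint union, homs $\bot$ between the parts) and $(T_1\otimes T_2)\mathcal A=T_1\mathcal A\otimes T_2\mathcal A$ (pairs, homs $T_1\mathcal A(x,x')\otimes T_2\mathcal A(y,y')$), both acting componentwise on 1-cells; $T^\partial\mathcal A=(T(\mathcal A^{op}))^{op}$ and $T^\partial f=(T(f^{op}))^{op}$; $\mathsf LT=\mathsf L\circ T$, where $\mathsf L\mathcal A=[\mathcal A^{op},\mathcal V]$ (the $\mathcal V$-category of $\mathcal V$-functors $\mathcal A^{op}\to\mathcal V$ with homs $\bigwedge_a[\phi a,\psi a]$) and $(\mathsf Lf)(\phi)(b)=\bigvee_a\phi(a)\otimes\mathcal B(b,fa)$ for $f:\mathcal A\to\mathcal B$. -}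

module Defs where

open import Level using (Level; suc; _⊔_)
open import Data.Empty.Polymorphic using (⊥)
open import Data.Sum using (_⊎_; inj₁; inj₂)
open import Data.Product using (_×_; _,_; proj₁; proj₂)
open import Relation.Binary.PropositionalEquality
  using (_≡_; refl; sym; trans; cong; cong₂; subst; module ≡-Reasoning)

record Quantale (ℓ : Level) : Set (suc ℓ) where
  infixr 7 _⊗_
  infix 4 _≤_
  field
    Carrier   : Set ℓ
    _≤_       : Carrier → Carrier → Set ℓ
    ≤-refl    : ∀ {x} → x ≤ x
    ≤-trans   : ∀ {x y z} → x ≤ y → y ≤ z → x ≤ z
    ≤-antisym : ∀ {x y} → x ≤ y → y ≤ x → x ≡ y
    ⋁         : {J : Set ℓ} → (J → Carrier) → Carrier
    ⋁-ub      : ∀ {J : Set ℓ} (h : J → Carrier) (j : J) → h j ≤ ⋁ h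
    ⋁-lub     : ∀ {J : Set ℓ} (h : J → Carrier) (x : Carrier) →
                (∀ j → h j ≤ x) → ⋁ h ≤ x
    ⋀         : {J : Set ℓ} → (J → Carrier) → Carrier
    ⋀-lb      : ∀ {J : Set ℓ} (h : J → Carrier) (j : J) → ⋀ h ≤ h j
    ⋀-glb     : ∀ {J : Set ℓ} (h : J → Carrier) (x : Carrier) →
                (∀ j → x ≤ h j) → x ≤ ⋀ h
    _⊗_       : Carrier → Carrier → Carrier
    I         : Carrier
    [_,_]     : Carrier → Carrier → Carrier
    ⊗-comm    : ∀ x y → x ⊗ y ≡ y ⊗ x
    ⊗-assoc   : ∀ x y z → (x ⊗ y) ⊗ z ≡ x ⊗ (y ⊗ z)
    ⊗-unitˡ   : ∀ x → I ⊗ x ≡ x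
    ⊗-⋁ʳ      : ∀ {J : Set ℓ} (x : Carrier) (h : J → Carrier) →
                x ⊗ ⋁ h ≡ ⋁ (λ j → x ⊗ h j)
    ⊗-⋁ˡ      : ∀ {J : Set ℓ} (x : Carrier) (h : J → Carrier) →
                ⋁ h ⊗ x ≡ ⋁ (λ j → h j ⊗ x)
    adj→      : ∀ {x y z} → x ⊗ y ≤ z → y ≤ [ x , z ]
    adj←      : ∀ {x y z} → y ≤ [ x , z ] → x ⊗ y ≤ z

  ⊥V : Carrier
  ⊥V = ⋁ {J = ⊥} (λ ())

module Basics {ℓ : Level} (𝒱 : Quantale ℓ) where
  open Quantale 𝒱

  ≡→≤ : ∀ {x y} → x ≡ y → x ≤ y
  ≡→≤ refl = ≤-refl

  ⊗-unitʳ : ∀ x → x ⊗ I ≡ x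
  ⊗-unitʳ x = trans (⊗-comm x I) (⊗-unitˡ x)

  ⊗-monoʳ : ∀ {x y y'} → y ≤ y' → x ⊗ y ≤ x ⊗ y'
  ⊗-monoʳ p = adj← (≤-trans p (adj→ ≤-refl))

  ⊗-monoˡ : ∀ {x x' y} → x ≤ x' → x ⊗ y ≤ x' ⊗ y
  ⊗-monoˡ {x} {x'} {y} p =
    ≤-trans (≡→≤ (⊗-comm x y)) (≤-trans (⊗-monoʳ p) (≡→≤ (⊗-comm y x')))

  ⊗-mono : ∀ {x x' y y'} → x ≤ x' → y ≤ y' → x ⊗ y ≤ x' ⊗ y'
  ⊗-mono p q = ≤-trans (⊗-monoˡ p) (⊗-monoʳ q)

  ⊥V≤ : ∀ x → ⊥V ≤ x
  ⊥V≤ x = ⋁-lub (λ ()) x (λ ())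

  ⊗⊥ : ∀ x z → x ⊗ ⊥V ≤ z
  ⊗⊥ x z = adj← (⊥V≤ _)

  ⊥⊗ : ∀ x z → ⊥V ⊗ x ≤ z
  ⊥⊗ x z = ≤-trans (≡→≤ (⊗-comm ⊥V x)) (⊗⊥ x z)

  ⋁-⊗-lub : ∀ {J : Set ℓ} {x z} (h : J → Carrier) →
            (∀ j → x ⊗ h j ≤ z) → x ⊗ ⋁ h ≤ z
  ⋁-⊗-lub h p = adj← (⋁-lub h _ (λ j → adj→ (p j)))

  ⋁-⊗-lubˡ : ∀ {J : Set ℓ} {x z} (h : J → Carrier) →
             (∀ j → h j ⊗ x ≤ z) → ⋁ h ⊗ x ≤ z
  ⋁-⊗-lubˡ {x = x} h p =
    ≤-trans (≡→≤ (⊗-comm (⋁ h) x))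
            (⋁-⊗-lub h (λ j → ≤-trans (≡→≤ (⊗-comm x (h j))) (p j)))

  interchange : ∀ a b c d → (a ⊗ b) ⊗ (c ⊗ d) ≡ (a ⊗ c) ⊗ (b ⊗ d)
  interchange a b c d = begin
      (a ⊗ b) ⊗ (c ⊗ d)   ≡⟨ ⊗-assoc a b (c ⊗ d) ⟩
      a ⊗ (b ⊗ (c ⊗ d))   ≡⟨ cong (a ⊗_) (sym (⊗-assoc b c d)) ⟩
      a ⊗ ((b ⊗ c) ⊗ d)   ≡⟨ cong (λ u → a ⊗ (u ⊗ d)) (⊗-comm b c) ⟩
      a ⊗ ((c ⊗ b) ⊗ d)   ≡⟨ cong (a ⊗_) (⊗-assoc c b d) ⟩
      a ⊗ (c ⊗ (b ⊗ d))   ≡⟨ sym (⊗-assoc a c (b ⊗ d)) ⟩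
      (a ⊗ c) ⊗ (b ⊗ d)   ∎
    where open ≡-Reasoning

  swap₁₂ : ∀ u v w → u ⊗ (v ⊗ w) ≡ v ⊗ (u ⊗ w)
  swap₁₂ u v w = trans (sym (⊗-assoc u v w))
                  (trans (cong (_⊗ w) (⊗-comm u v)) (⊗-assoc v u w))

  I≤[a,a] : ∀ a → I ≤ [ a , a ]
  I≤[a,a] a = adj→ (≡→≤ (⊗-unitʳ a))

  []-comp : ∀ a b c → [ b , c ] ⊗ [ a , b ] ≤ [ a , c ]
  []-comp a b c = adj→
    (≤-trans (≡→≤ (swap₁₂ a [ b , c ] [ a , b ]))
    (≤-trans (⊗-monoʳ (adj← ≤-refl))
    (≤-trans (≡→≤ (⊗-comm [ b , c ] b)) (adj← ≤-refl))))

module VCatTheory {ℓ : Level} (𝒱 : Quantale ℓ) where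
  open Quantale 𝒱
  open Basics 𝒱

  record VCat : Set (suc ℓ) where
    field
      Obj  : Set ℓ
      hom  : Obj → Obj → Carrier
      hom-id   : ∀ a → I ≤ hom a a
      hom-comp : ∀ a b c → hom b c ⊗ hom a b ≤ hom a c
  open VCat public

  record VFun (𝒜 ℬ : VCat) : Set ℓ where
    field
      map  : Obj 𝒜 → Obj ℬ
      mono : ∀ a a' → hom 𝒜 a a' ≤ hom ℬ (map a) (map a')
  open VFun public

  _≤F_ : ∀ {𝒜 ℬ} → VFun 𝒜 ℬ → VFun 𝒜 ℬ → Set ℓ
  _≤F_ {𝒜} {ℬ} f g = ∀ a → I ≤ hom ℬ (map f a) (map g a)

  idF : ∀ {𝒜} → VFun 𝒜 𝒜
  idF = record { map = λ a → a ; mono = λ a a' → ≤-refl }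

  _∘F_ : ∀ {𝒜 ℬ 𝒞} → VFun ℬ 𝒞 → VFun 𝒜 ℬ → VFun 𝒜 𝒞
  g ∘F f = record
    { map = λ a → map g (map f a)
    ; mono = λ a a' → ≤-trans (mono f a a') (mono g (map f a) (map f a')) }

  op : VCat → VCat
  op 𝒜 = record
    { Obj = Obj 𝒜
    ; hom = λ a b → hom 𝒜 b a
    ; hom-id = hom-id 𝒜
    ; hom-comp = λ a b c →
        ≤-trans (≡→≤ (⊗-comm (hom 𝒜 c b) (hom 𝒜 b a))) (hom-comp 𝒜 c b a) }

  opF : ∀ {𝒜 ℬ} → VFun 𝒜 ℬ → VFun (op 𝒜) (op ℬ)
  opF f = record { map = map f ; mono = λ a a' → mono f a' a }

  Vᶜ : VCat
  Vᶜ = record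
    { Obj = Carrier
    ; hom = [_,_]
    ; hom-id = I≤[a,a]
    ; hom-comp = []-comp }

  -- A lax square   P --p₁--> B
  --                |p₀       |g
  --                v         v
  --                A --f---> C      with  f p₀ ≤ g p₁
  IsLax : ∀ {𝒫 𝒜 ℬ 𝒞} → VFun 𝒫 𝒜 → VFun 𝒫 ℬ → VFun 𝒜 𝒞 → VFun ℬ 𝒞 → Set ℓ
  IsLax p₀ p₁ f g = (f ∘F p₀) ≤F (g ∘F p₁)

  IsExact : ∀ {𝒫 𝒜 ℬ 𝒞} → VFun 𝒫 𝒜 → VFun 𝒫 ℬ → VFun 𝒜 𝒞 → VFun ℬ 𝒞 → Set ℓ
  IsExact {𝒫} {𝒜} {ℬ} {𝒞} p₀ p₁ f g =
    ∀ (a : Obj 𝒜) (b : Obj ℬ) →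
      hom 𝒞 (map f a) (map g b)
        ≡ ⋁ {J = Obj 𝒫} (λ w → hom 𝒜 a (map p₀ w) ⊗ hom ℬ (map p₁ w) b)

  ExactLaxSquare : ∀ {𝒫 𝒜 ℬ 𝒞} →
    VFun 𝒫 𝒜 → VFun 𝒫 ℬ → VFun 𝒜 𝒞 → VFun ℬ 𝒞 → Set ℓ
  ExactLaxSquare p₀ p₁ f g = IsLax p₀ p₁ f g × IsExact p₀ p₁ f g

  sumHom : ∀ (𝒜 ℬ : VCat) → Obj 𝒜 ⊎ Obj ℬ → Obj 𝒜 ⊎ Obj ℬ → Carrier
  sumHom 𝒜 ℬ (inj₁ a) (inj₁ a') = hom 𝒜 a a'
  sumHom 𝒜 ℬ (inj₁ a) (inj₂ b)  = ⊥V
  sumHom 𝒜 ℬ (inj₂ b) (inj₁ a)  = ⊥V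
  sumHom 𝒜 ℬ (inj₂ b) (inj₂ b') = hom ℬ b b'

  sumId : ∀ 𝒜 ℬ x → I ≤ sumHom 𝒜 ℬ x x
  sumId 𝒜 ℬ (inj₁ a) = hom-id 𝒜 a
  sumId 𝒜 ℬ (inj₂ b) = hom-id ℬ b

  sumComp : ∀ 𝒜 ℬ x y z → sumHom 𝒜 ℬ y z ⊗ sumHom 𝒜 ℬ x y ≤ sumHom 𝒜 ℬ x z
  sumComp 𝒜 ℬ (inj₁ a) (inj₁ b) (inj₁ c) = hom-comp 𝒜 a b c
  sumComp 𝒜 ℬ (inj₁ a) (inj₁ b) (inj₂ c) = ⊥⊗ _ _
  sumComp 𝒜 ℬ (inj₁ a) (inj₂ b) (inj₁ c) = ⊥⊗ _ _
  sumComp 𝒜 ℬ (inj₁ a) (inj₂ b) (inj₂ c) = ⊗⊥ _ _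
  sumComp 𝒜 ℬ (inj₂ a) (inj₁ b) (inj₁ c) = ⊗⊥ _ _
  sumComp 𝒜 ℬ (inj₂ a) (inj₁ b) (inj₂ c) = ⊥⊗ _ _
  sumComp 𝒜 ℬ (inj₂ a) (inj₂ b) (inj₁ c) = ⊥⊗ _ _
  sumComp 𝒜 ℬ (inj₂ a) (inj₂ b) (inj₂ c) = hom-comp ℬ a b c

  _+ᶜ_ : VCat → VCat → VCat
  𝒜 +ᶜ ℬ = record
    { Obj = Obj 𝒜 ⊎ Obj ℬ
    ; hom = sumHom 𝒜 ℬ
    ; hom-id = sumId 𝒜 ℬ
    ; hom-comp = sumComp 𝒜 ℬ }

  sumMap : ∀ {𝒜 𝒜' ℬ ℬ'} → VFun 𝒜 𝒜' → VFun ℬ ℬ' →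
           Obj 𝒜 ⊎ Obj ℬ → Obj 𝒜' ⊎ Obj ℬ'
  sumMap f g (inj₁ a) = inj₁ (map f a)
  sumMap f g (inj₂ b) = inj₂ (map g b)

  sumMono : ∀ {𝒜 𝒜' ℬ ℬ'} (f : VFun 𝒜 𝒜') (g : VFun ℬ ℬ') x y →
            sumHom 𝒜 ℬ x y ≤ sumHom 𝒜' ℬ' (sumMap f g x) (sumMap f g y)
  sumMono f g (inj₁ a) (inj₁ a') = mono f a a'
  sumMono f g (inj₁ a) (inj₂ b)  = ≤-refl
  sumMono f g (inj₂ b) (inj₁ a)  = ≤-refl
  sumMono f g (inj₂ b) (inj₂ b') = mono g b b'

  _+ᶠ_ : ∀ {𝒜 𝒜' ℬ ℬ'} → VFun 𝒜 𝒜' → VFun ℬ ℬ' → VFun (𝒜 +ᶜ ℬ) (𝒜' +ᶜ ℬ')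
  f +ᶠ g = record { map = sumMap f g ; mono = sumMono f g }

  _⊗ᶜ_ : VCat → VCat → VCat
  𝒜 ⊗ᶜ ℬ = record
    { Obj = Obj 𝒜 × Obj ℬ
    ; hom = λ x y → hom 𝒜 (proj₁ x) (proj₁ y) ⊗ hom ℬ (proj₂ x) (proj₂ y)
    ; hom-id = λ x → ≤-trans (≡→≤ (sym (⊗-unitˡ I)))
                              (⊗-mono (hom-id 𝒜 (proj₁ x)) (hom-id ℬ (proj₂ x)))
    ; hom-comp = λ x y z →
        ≤-trans (≡→≤ (interchange _ _ _ _))
                (⊗-mono (hom-comp 𝒜 _ _ _) (hom-comp ℬ _ _ _)) }

  _⊗ᶠ_ : ∀ {𝒜 𝒜' ℬ ℬ'} → VFun 𝒜 𝒜' → VFun ℬ ℬ' → VFun (𝒜 ⊗ᶜ ℬ) (𝒜' ⊗ᶜ ℬ')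
  f ⊗ᶠ g = record
    { map = λ x → map f (proj₁ x) , map g (proj₂ x)
    ; mono = λ x y → ⊗-mono (mono f _ _) (mono g _ _) }

  L : VCat → VCat
  L 𝒜 = record
    { Obj = VFun (op 𝒜) Vᶜ
    ; hom = λ φ ψ → ⋀ {J = Obj 𝒜} (λ a → [ map φ a , map ψ a ])
    ; hom-id = λ φ → ⋀-glb _ I (λ a → I≤[a,a] (map φ a))
    ; hom-comp = λ φ ψ χ → ⋀-glb _ _ (λ a →
        ≤-trans (⊗-mono (⋀-lb _ a) (⋀-lb _ a)) ([]-comp _ _ _)) }

  Lobj : ∀ {𝒜 ℬ} → VFun 𝒜 ℬ → VFun (op 𝒜) Vᶜ → VFun (op ℬ) Vᶜ
  Lobj {𝒜} {ℬ} f φ = record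
    { map = λ b → ⋁ {J = Obj 𝒜} (λ a → map φ a ⊗ hom ℬ b (map f a))
    ; mono = λ b b' → adj→ (⋁-⊗-lubˡ _ (λ a →
        ≤-trans (≡→≤ (⊗-assoc (map φ a) (hom ℬ b (map f a)) (hom ℬ b' b)))
        (≤-trans (⊗-monoʳ (hom-comp ℬ b' b (map f a)))
                 (⋁-ub (λ a → map φ a ⊗ hom ℬ b' (map f a)) a)))) }

  Lmap : ∀ {𝒜 ℬ} → VFun 𝒜 ℬ → VFun (L 𝒜) (L ℬ)
  Lmap {𝒜} {ℬ} f = record
    { map = Lobj f
    ; mono = λ φ ψ → ⋀-glb _ _ (λ b → adj→ (⋁-⊗-lubˡ _ (λ a →
        ≤-trans (≡→≤ (trans (⊗-assoc (map φ a) (hom ℬ b (map f a)) _)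
                     (trans (cong (map φ a ⊗_) (⊗-comm (hom ℬ b (map f a)) _))
                            (sym (⊗-assoc (map φ a) _ (hom ℬ b (map f a)))))))
        (≤-trans (⊗-monoˡ (adj← (⋀-lb (λ a → [ map φ a , map ψ a ]) a)))
                 (⋁-ub (λ a → map ψ a ⊗ hom ℬ b (map f a)) a))))) }

  infixl 6 _⊕_
  infixl 7 _⊛_
  data Kripke : Set (suc ℓ) where
    Id    : Kripke
    const : VCat → Kripke
    _⊕_   : Kripke → Kripke → Kripke
    _⊛_   : Kripke → Kripke → Kripke
    _∂    : Kripke → Kripke
    L·    : Kripke → Kripke

  ⟦_⟧₀ : Kripke → VCat → VCat
  ⟦ Id ⟧₀ 𝒜 = 𝒜
  ⟦ const 𝒳 ⟧₀ 𝒜 = 𝒳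
  ⟦ T₁ ⊕ T₂ ⟧₀ 𝒜 = ⟦ T₁ ⟧₀ 𝒜 +ᶜ ⟦ T₂ ⟧₀ 𝒜
  ⟦ T₁ ⊛ T₂ ⟧₀ 𝒜 = ⟦ T₁ ⟧₀ 𝒜 ⊗ᶜ ⟦ T₂ ⟧₀ 𝒜
  ⟦ T ∂ ⟧₀ 𝒜 = op (⟦ T ⟧₀ (op 𝒜))
  ⟦ L· T ⟧₀ 𝒜 = L (⟦ T ⟧₀ 𝒜)

  ⟦_⟧₁ : (T : Kripke) → ∀ {𝒜 ℬ} → VFun 𝒜 ℬ → VFun (⟦ T ⟧₀ 𝒜) (⟦ T ⟧₀ ℬ)
  ⟦ Id ⟧₁ f = f
  ⟦ const 𝒳 ⟧₁ f = idF
  ⟦ T₁ ⊕ T₂ ⟧₁ f = ⟦ T₁ ⟧₁ f +ᶠ ⟦ T₂ ⟧₁ f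
  ⟦ T₁ ⊛ T₂ ⟧₁ f = ⟦ T₁ ⟧₁ f ⊗ᶠ ⟦ T₂ ⟧₁ f
  ⟦ T ∂ ⟧₁ f = opF (⟦ T ⟧₁ (opF f))
  ⟦ L· T ⟧₁ f = Lmap (⟦ T ⟧₁ f)

-- Exactness of a lax square is an equation C(f a , g b) = ⋁_w A(a , p₀ w) ⊗ B(p₁ w , b), and
-- for any lax square the inequality ≥ is automatic (compose across the 2-cell I ≤ C(f p₀ w , g p₁ w)).
-- So each constructor only has to produce, from exact squares for its arguments, a witness w
-- bounding C(f a , g b) from above: Id, const, + and ⊗ do this componentwise, and T^∂ reduces
-- to T by transposing the square in op. For L, given presheaves φ, ψ, the witness is the
-- restriction ψ ∘ p₁ of ψ along p₁; that it works is Beck–Chevalley for presheaves,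
-- (L g ψ)(f a) ≤ (L p₀ (ψ ∘ p₁))(a), which is exactly where exactness of the given square enters.
module Submission where

open import Level using (Level)
open import Data.Sum using (inj₁; inj₂)
open import Data.Product using (_,_; proj₁; proj₂)
open import Relation.Binary.PropositionalEquality using (_≡_; sym; isEquivalence)
open import Relation.Binary.Bundles using (Poset)
open import Defs

module BeckChevalley {ℓ : Level} (𝒱 : Quantale ℓ) where
  open Quantale 𝒱
  open Basics 𝒱
  open VCatTheory 𝒱

  ≤-poset : Poset ℓ ℓ ℓ
  ≤-poset = record
    { isPartialOrder = record
      { isPreorder = record
        { isEquivalence = isEquivalence ; reflexive = ≡→≤ ; trans = ≤-trans }
      ; antisym = ≤-antisym } }

  open import Relation.Binary.Reasoning.PartialOrder ≤-poset

  ⋁-mono : ∀ {J : Set ℓ} {h k : J → Carrier} → (∀ j → h j ≤ k j) → ⋁ h ≤ ⋁ k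
  ⋁-mono {k = k} h≤k = ⋁-lub _ _ (λ j → ≤-trans (h≤k j) (⋁-ub k j))

  ≤⇒I≤[,] : ∀ {x y} → x ≤ y → I ≤ [ x , y ]
  ≤⇒I≤[,] {x} x≤y = adj→ (≤-trans (≡→≤ (⊗-unitʳ x)) x≤y)

  hom-postcomp : ∀ (𝒳 : VCat) {x y z} → I ≤ hom 𝒳 y z → hom 𝒳 x y ≤ hom 𝒳 x z
  hom-postcomp 𝒳 {x} {y} {z} I≤yz = begin
    hom 𝒳 x y                 ≡⟨ sym (⊗-unitˡ _) ⟩
    I ⊗ hom 𝒳 x y             ≤⟨ ⊗-monoˡ I≤yz ⟩
    hom 𝒳 y z ⊗ hom 𝒳 x y     ≤⟨ hom-comp 𝒳 x y z ⟩
    hom 𝒳 x z                 ∎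

  hom-bridge : ∀ (𝒳 : VCat) {x m n y} → I ≤ hom 𝒳 m n →
               hom 𝒳 x m ⊗ hom 𝒳 n y ≤ hom 𝒳 x y
  hom-bridge 𝒳 {x} {m} {n} {y} I≤mn = begin
    hom 𝒳 x m ⊗ hom 𝒳 n y     ≤⟨ ⊗-monoˡ (hom-postcomp 𝒳 I≤mn) ⟩
    hom 𝒳 x n ⊗ hom 𝒳 n y     ≡⟨ ⊗-comm _ _ ⟩
    hom 𝒳 n y ⊗ hom 𝒳 x n     ≤⟨ hom-comp 𝒳 x n y ⟩
    hom 𝒳 x y                 ∎

  -- Bundled so that a square can be passed explicitly: its 1-cells cannot be inferred
  -- from an ExactLaxSquare type, which unfolds to a Π-type.
  record Square (𝒫 𝒜 ℬ 𝒞 : VCat) : Set ℓ where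
    constructor square
    field
      p₀ : VFun 𝒫 𝒜
      p₁ : VFun 𝒫 ℬ
      f  : VFun 𝒜 𝒞
      g  : VFun ℬ 𝒞

  module _ {𝒫 𝒜 ℬ 𝒞 : VCat} where

    Lax Exact : Square 𝒫 𝒜 ℬ 𝒞 → Set ℓ
    Lax   (square p₀ p₁ f g) = IsLax p₀ p₁ f g
    Exact (square p₀ p₁ f g) = ExactLaxSquare p₀ p₁ f g

    cospanHom : Square 𝒫 𝒜 ℬ 𝒞 → Obj 𝒜 → Obj ℬ → Carrier
    cospanHom (square _ _ f g) a b = hom 𝒞 (map f a) (map g b)

    viaSpan : Square 𝒫 𝒜 ℬ 𝒞 → Obj 𝒜 → Obj ℬ → Carrier
    viaSpan (square p₀ p₁ _ _) a b =
      ⋁ {J = Obj 𝒫} (λ w → hom 𝒜 a (map p₀ w) ⊗ hom ℬ (map p₁ w) b)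

    viaSpan≤cospanHom : ∀ s → Lax s → ∀ a b → viaSpan s a b ≤ cospanHom s a b
    viaSpan≤cospanHom (square _ _ f g) lax a b = ⋁-lub _ _ (λ w →
      ≤-trans (⊗-mono (mono f _ _) (mono g _ _)) (hom-bridge 𝒞 (lax w)))

    exactLaxSquare : ∀ s → Lax s → (∀ a b → cospanHom s a b ≤ viaSpan s a b) → Exact s
    exactLaxSquare s lax hom≤viaSpan =
      lax , λ a b → ≤-antisym (hom≤viaSpan a b) (viaSpan≤cospanHom s lax a b)

    cospanHom≤viaSpan : ∀ s → Exact s → ∀ a b → cospanHom s a b ≤ viaSpan s a b
    cospanHom≤viaSpan _ (_ , exact) a b = ≡→≤ (exact a b)

  transpose : ∀ {𝒫 𝒜 ℬ 𝒞} → Square 𝒫 𝒜 ℬ 𝒞 → Square (op 𝒫) (op ℬ) (op 𝒜) (op 𝒞)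
  transpose (square p₀ p₁ f g) = square (opF p₁) (opF p₀) (opF g) (opF f)

  transpose-exact : ∀ {𝒫 𝒜 ℬ 𝒞} (s : Square 𝒫 𝒜 ℬ 𝒞) → Exact s → Exact (transpose s)
  transpose-exact s sq@(lax , _) = exactLaxSquare (transpose s) lax (λ b a →
    ≤-trans (cospanHom≤viaSpan s sq a b) (⋁-mono (λ w → ≡→≤ (⊗-comm _ _))))

  identitySquare : ∀ 𝒳 → Square 𝒳 𝒳 𝒳 𝒳
  identitySquare 𝒳 = square idF idF idF idF

  identitySquare-exact : ∀ 𝒳 → Exact (identitySquare 𝒳)
  identitySquare-exact 𝒳 = exactLaxSquare (identitySquare 𝒳) (hom-id 𝒳) (λ a b → begin
    hom 𝒳 a b                        ≡⟨ sym (⊗-unitˡ _) ⟩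
    I ⊗ hom 𝒳 a b                    ≤⟨ ⊗-monoˡ (hom-id 𝒳 a) ⟩
    hom 𝒳 a a ⊗ hom 𝒳 a b            ≤⟨ ⋁-ub (λ w → hom 𝒳 a w ⊗ hom 𝒳 w b) a ⟩
    viaSpan (identitySquare 𝒳) a b   ∎)

  module _ {𝒫 𝒜 ℬ 𝒞 𝒫' 𝒜' ℬ' 𝒞' : VCat} where

    _+ˢ_ : Square 𝒫 𝒜 ℬ 𝒞 → Square 𝒫' 𝒜' ℬ' 𝒞' →
           Square (𝒫 +ᶜ 𝒫') (𝒜 +ᶜ 𝒜') (ℬ +ᶜ ℬ') (𝒞 +ᶜ 𝒞')
    square p₀ p₁ f g +ˢ square p₀' p₁' f' g' =
      square (p₀ +ᶠ p₀') (p₁ +ᶠ p₁') (f +ᶠ f') (g +ᶠ g')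

    _⊗ˢ_ : Square 𝒫 𝒜 ℬ 𝒞 → Square 𝒫' 𝒜' ℬ' 𝒞' →
           Square (𝒫 ⊗ᶜ 𝒫') (𝒜 ⊗ᶜ 𝒜') (ℬ ⊗ᶜ ℬ') (𝒞 ⊗ᶜ 𝒞')
    square p₀ p₁ f g ⊗ˢ square p₀' p₁' f' g' =
      square (p₀ ⊗ᶠ p₀') (p₁ ⊗ᶠ p₁') (f ⊗ᶠ f') (g ⊗ᶠ g')

    +ˢ-exact : ∀ s s' → Exact s → Exact s' → Exact (s +ˢ s')
    +ˢ-exact s s' sq sq' = exactLaxSquare (s +ˢ s') lax hom≤viaSpan
      where
      lax : Lax (s +ˢ s')
      lax (inj₁ w) = proj₁ sq w
      lax (inj₂ w) = proj₁ sq' w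

      hom≤viaSpan : ∀ a b → cospanHom (s +ˢ s') a b ≤ viaSpan (s +ˢ s') a b
      hom≤viaSpan (inj₁ a) (inj₁ b) =
        ≤-trans (cospanHom≤viaSpan s sq a b) (⋁-lub _ _ (λ w → ⋁-ub _ (inj₁ w)))
      hom≤viaSpan (inj₁ a) (inj₂ b) = ⊥V≤ _
      hom≤viaSpan (inj₂ a) (inj₁ b) = ⊥V≤ _
      hom≤viaSpan (inj₂ a) (inj₂ b) =
        ≤-trans (cospanHom≤viaSpan s' sq' a b) (⋁-lub _ _ (λ w → ⋁-ub _ (inj₂ w)))

    ⊗ˢ-exact : ∀ s s' → Exact s → Exact s' → Exact (s ⊗ˢ s')
    ⊗ˢ-exact s s' sq sq' = exactLaxSquare (s ⊗ˢ s')
      (λ (w , w') → ≤-trans (≡→≤ (sym (⊗-unitˡ I))) (⊗-mono (proj₁ sq w) (proj₁ sq' w')))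
      (λ (a , a') (b , b') → begin
        cospanHom (s ⊗ˢ s') (a , a') (b , b')
          ≤⟨ ⊗-mono (cospanHom≤viaSpan s sq a b) (cospanHom≤viaSpan s' sq' a' b') ⟩
        viaSpan s a b ⊗ viaSpan s' a' b'
          ≤⟨ ⋁-⊗-lubˡ _ (λ w → ⋁-⊗-lub _ (λ w' →
               ≤-trans (≡→≤ (interchange _ _ _ _)) (⋁-ub _ (w , w')))) ⟩
        viaSpan (s ⊗ˢ s') (a , a') (b , b')
          ∎)

  Presheaf : VCat → Set ℓ
  Presheaf 𝒳 = VFun (op 𝒳) Vᶜ

  presheaf-act : ∀ {𝒳} (ψ : Presheaf 𝒳) x y → map ψ x ⊗ hom 𝒳 y x ≤ map ψ y
  presheaf-act ψ x y = adj← (mono ψ x y)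

  homL-eval : ∀ {𝒳} (φ ψ : Presheaf 𝒳) x → map φ x ⊗ hom (L 𝒳) φ ψ ≤ map ψ x
  homL-eval φ ψ x = adj← (⋀-lb (λ x → [ map φ x , map ψ x ]) x)

  pointwise⇒I≤homL : ∀ {𝒳} (φ ψ : Presheaf 𝒳) →
    (∀ x → map φ x ≤ map ψ x) → I ≤ hom (L 𝒳) φ ψ
  pointwise⇒I≤homL φ ψ φ≤ψ = ⋀-glb _ I (λ x → ≤⇒I≤[,] (φ≤ψ x))

  module _ {𝒜 ℬ : VCat} where

    Lobj-unit : ∀ (f : VFun 𝒜 ℬ) (φ : Presheaf 𝒜) a → map φ a ≤ map (Lobj f φ) (map f a)
    Lobj-unit f φ a = begin
      map φ a                                  ≡⟨ sym (⊗-unitʳ _) ⟩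
      map φ a ⊗ I                              ≤⟨ ⊗-monoʳ (hom-id ℬ (map f a)) ⟩
      map φ a ⊗ hom ℬ (map f a) (map f a)      ≤⟨ ⋁-ub _ a ⟩
      map (Lobj f φ) (map f a)                 ∎

    Lobj-counit : ∀ (f : VFun 𝒜 ℬ) (ψ : Presheaf ℬ) b → map (Lobj f (ψ ∘F opF f)) b ≤ map ψ b
    Lobj-counit f ψ b = ⋁-lub _ _ (λ a → presheaf-act ψ (map f a) b)

    Lobj-mono₂ : ∀ {f g : VFun 𝒜 ℬ} → f ≤F g →
      ∀ (φ : Presheaf 𝒜) b → map (Lobj f φ) b ≤ map (Lobj g φ) b
    Lobj-mono₂ f≤g φ b = ⋁-mono (λ a → ⊗-monoʳ (hom-postcomp ℬ (f≤g a)))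

  Lobj-∘ : ∀ {𝒫 𝒜 ℬ} (p : VFun 𝒫 𝒜) (f : VFun 𝒜 ℬ) (χ : Presheaf 𝒫) b →
    map (Lobj f (Lobj p χ)) b ≡ map (Lobj (f ∘F p) χ) b
  Lobj-∘ {𝒫} {𝒜} {ℬ} p f χ b = ≤-antisym
    (⋁-lub _ _ (λ a → ⋁-⊗-lubˡ _ (λ w → begin
      (map χ w ⊗ hom 𝒜 a (map p w)) ⊗ hom ℬ b (map f a)
        ≡⟨ ⊗-assoc _ _ _ ⟩
      map χ w ⊗ (hom 𝒜 a (map p w) ⊗ hom ℬ b (map f a))
        ≤⟨ ⊗-monoʳ (≤-trans (⊗-monoˡ (mono f _ _)) (hom-comp ℬ _ _ _)) ⟩
      map χ w ⊗ hom ℬ b (map f (map p w))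
        ≤⟨ ⋁-ub _ w ⟩
      map (Lobj (f ∘F p) χ) b
        ∎)))
    (⋁-lub _ _ (λ w → begin
      map χ w ⊗ hom ℬ b (map f (map p w))
        ≤⟨ ⊗-monoˡ (Lobj-unit p χ w) ⟩
      map (Lobj p χ) (map p w) ⊗ hom ℬ b (map f (map p w))
        ≤⟨ ⋁-ub _ (map p w) ⟩
      map (Lobj f (Lobj p χ)) b
        ∎))

  Lˢ : ∀ {𝒫 𝒜 ℬ 𝒞} → Square 𝒫 𝒜 ℬ 𝒞 → Square (L 𝒫) (L 𝒜) (L ℬ) (L 𝒞)
  Lˢ (square p₀ p₁ f g) = square (Lmap p₀) (Lmap p₁) (Lmap f) (Lmap g)

  module _ {𝒫 𝒜 ℬ 𝒞 : VCat} where

    Lˢ-lax : ∀ (s : Square 𝒫 𝒜 ℬ 𝒞) → Lax s → Lax (Lˢ s)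
    Lˢ-lax (square p₀ p₁ f g) lax χ =
      pointwise⇒I≤homL {𝒞} (Lobj f (Lobj p₀ χ)) (Lobj g (Lobj p₁ χ)) (λ c → begin
        map (Lobj f (Lobj p₀ χ)) c    ≡⟨ Lobj-∘ p₀ f χ c ⟩
        map (Lobj (f ∘F p₀) χ) c      ≤⟨ Lobj-mono₂ {f = f ∘F p₀} {g ∘F p₁} lax χ c ⟩
        map (Lobj (g ∘F p₁) χ) c      ≡⟨ sym (Lobj-∘ p₁ g χ c) ⟩
        map (Lobj g (Lobj p₁ χ)) c    ∎)

    Lobj-beckChevalley : ∀ p₀ p₁ f g → Exact (square {𝒫} {𝒜} {ℬ} {𝒞} p₀ p₁ f g) →
      ∀ (ψ : Presheaf ℬ) a → map (Lobj g ψ) (map f a) ≤ map (Lobj p₀ (ψ ∘F opF p₁)) a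
    Lobj-beckChevalley p₀ p₁ f g sq ψ a = ⋁-lub _ _ (λ b →
      ≤-trans (⊗-monoʳ (cospanHom≤viaSpan (square p₀ p₁ f g) sq a b)) (⋁-⊗-lub _ (λ w → begin
        map ψ b ⊗ (hom 𝒜 a (map p₀ w) ⊗ hom ℬ (map p₁ w) b)
          ≡⟨ swap₁₂ _ _ _ ⟩
        hom 𝒜 a (map p₀ w) ⊗ (map ψ b ⊗ hom ℬ (map p₁ w) b)
          ≤⟨ ⊗-monoʳ (presheaf-act ψ b (map p₁ w)) ⟩
        hom 𝒜 a (map p₀ w) ⊗ map ψ (map p₁ w)
          ≡⟨ ⊗-comm _ _ ⟩
        map ψ (map p₁ w) ⊗ hom 𝒜 a (map p₀ w)
          ≤⟨ ⋁-ub _ w ⟩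
        map (Lobj p₀ (ψ ∘F opF p₁)) a
          ∎)))

    Lˢ-exact : ∀ (s : Square 𝒫 𝒜 ℬ 𝒞) → Exact s → Exact (Lˢ s)
    Lˢ-exact s@(square p₀ p₁ f g) sq@(lax , _) = exactLaxSquare (Lˢ s) (Lˢ-lax s lax) hom≤viaSpan
      where
      hom≤viaSpan : ∀ φ ψ → cospanHom (Lˢ s) φ ψ ≤ viaSpan (Lˢ s) φ ψ
      hom≤viaSpan φ ψ = begin
        u                                                      ≡⟨ sym (⊗-unitʳ u) ⟩
        u ⊗ I                                                  ≤⟨ ⊗-mono u≤hom-restriction
                                                                    restriction-counit ⟩
        hom (L 𝒜) φ (Lobj p₀ χ) ⊗ hom (L ℬ) (Lobj p₁ χ) ψ     ≤⟨ ⋁-ub _ χ ⟩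
        viaSpan (Lˢ s) φ ψ                                     ∎
        where
        u = hom (L 𝒞) (Lobj f φ) (Lobj g ψ)
        χ = ψ ∘F opF p₁

        u≤hom-restriction : u ≤ hom (L 𝒜) φ (Lobj p₀ χ)
        u≤hom-restriction = ⋀-glb _ u (λ a → adj→ (begin
          map φ a ⊗ u                      ≤⟨ ⊗-monoˡ (Lobj-unit f φ a) ⟩
          map (Lobj f φ) (map f a) ⊗ u     ≤⟨ homL-eval {𝒞} (Lobj f φ) (Lobj g ψ) (map f a) ⟩
          map (Lobj g ψ) (map f a)         ≤⟨ Lobj-beckChevalley p₀ p₁ f g sq ψ a ⟩
          map (Lobj p₀ χ) a                ∎))

        restriction-counit : I ≤ hom (L ℬ) (Lobj p₁ χ) ψ
        restriction-counit = pointwise⇒I≤homL {ℬ} (Lobj p₁ χ) ψ (Lobj-counit p₁ ψ)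

  ⟦_⟧ˢ : ∀ (T : Kripke) {𝒫 𝒜 ℬ 𝒞} → Square 𝒫 𝒜 ℬ 𝒞 →
         Square (⟦ T ⟧₀ 𝒫) (⟦ T ⟧₀ 𝒜) (⟦ T ⟧₀ ℬ) (⟦ T ⟧₀ 𝒞)
  ⟦ T ⟧ˢ (square p₀ p₁ f g) = square (⟦ T ⟧₁ p₀) (⟦ T ⟧₁ p₁) (⟦ T ⟧₁ f) (⟦ T ⟧₁ g)

  kripke-exact : ∀ (T : Kripke) {𝒫 𝒜 ℬ 𝒞} (s : Square 𝒫 𝒜 ℬ 𝒞) → Exact s → Exact (⟦ T ⟧ˢ s)
  kripke-exact Id        s sq = sq
  kripke-exact (const 𝒳) s sq = identitySquare-exact 𝒳
  kripke-exact (T₁ ⊕ T₂) s sq =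
    +ˢ-exact (⟦ T₁ ⟧ˢ s) (⟦ T₂ ⟧ˢ s) (kripke-exact T₁ s sq) (kripke-exact T₂ s sq)
  kripke-exact (T₁ ⊛ T₂) s sq =
    ⊗ˢ-exact (⟦ T₁ ⟧ˢ s) (⟦ T₂ ⟧ˢ s) (kripke-exact T₁ s sq) (kripke-exact T₂ s sq)
  kripke-exact (T ∂)     s sq =
    transpose-exact (⟦ T ⟧ˢ (transpose s))
      (kripke-exact T (transpose s) (transpose-exact s sq))
  kripke-exact (L· T)    s sq = Lˢ-exact (⟦ T ⟧ˢ s) (kripke-exact T s sq)

proposition6p4 : ∀ {ℓ : Level} (𝒱 : Quantale ℓ) → let open VCatTheory 𝒱 in
    (T : Kripke) {𝒫 𝒜 ℬ 𝒞 : VCat}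
    (p₀ : VFun 𝒫 𝒜) (p₁ : VFun 𝒫 ℬ) (f : VFun 𝒜 𝒞) (g : VFun ℬ 𝒞) →
    ExactLaxSquare p₀ p₁ f g →
    ExactLaxSquare (⟦ T ⟧₁ p₀) (⟦ T ⟧₁ p₁) (⟦ T ⟧₁ f) (⟦ T ⟧₁ g)
proposition6p4 𝒱 T p₀ p₁ f g =
  BeckChevalley.kripke-exact 𝒱 T (BeckChevalley.square p₀ p₁ f g)
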